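{- Let $G$ be a finite connected graph, $W$ a positive weight function on $G$, $v_0\in V(G)$, and $D$ a distribution on $G$ such that $D(s)\le W(s)$ for all $s\ne v_0$. If $V_{\{v_0\}}(D)\le V_{\{v_0\}}(W)$, then there exists a distribution $D^*$ on $G$ that is derivable from $D$, satisfies $D^*(q)\le W(q)$ for all $q\in V(G)$, and has $V_{\{v_0\}}(D^*)=V_{\{v_0\}}(D)$.
   Context: A distribution (or weight function) on $G$ is a function $V(G)\to\mathbb{Z}_{\ge 0}$; a positive weight function has all values $\ge 1$. For adjacent vertices $p,q$, the pebbling move $P_{p,q}$ sends $D$ to the function equal to $D(p)-2$ at $p$, $D(q)+1$ at $q$, and $D$ elsewhere; it is legal if the result is nonnegative. $D'$ is derivable from $D$ if $D'$ is obtained from $D$ by a finite sequence of legal pebbling moves (possibly none). For nonempty $S\subseteq V(G)$, $V_S(D)=\sum_{q\in V(G)} D(q)\,2^{d(q,S)}$ with $d(q,S)=\min_{r\in S}d(q,r)$, $d$ the graph distance. -}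

module Defs where

open import Data.Nat using (ℕ; zero; suc; _+_; _*_; _∸_; _^_; _≤_)
open import Data.Fin using (Fin)
open import Data.Fin.Properties using (_≟_)
open import Data.List using (List; map; allFin)
open import Data.Nat.ListAction using (sum)
open import Data.Product using (Σ; ∃; ∃-syntax; _×_)
open import Relation.Nullary using (¬_; yes; no)
open import Relation.Binary.PropositionalEquality using (_≡_)
open import Relation.Binary.Construct.Closure.ReflexiveTransitive using (Star)

record Graph : Set₁ where
  field
    n     : ℕ
    Adj   : Fin n → Fin n → Set
    sym   : ∀ {u v} → Adj u v → Adj v u
    irrefl : ∀ {u} → ¬ Adj u u

open Graph public

Vertex : Graph → Set
Vertex G = Fin (n G)

data Walk (G : Graph) : Vertex G → Vertex G → ℕ → Set where
  here : ∀ {u} → Walk G u u zero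
  step : ∀ {u w v k} → Adj G u w → Walk G w v k → Walk G u v (suc k)

Connected : Graph → Set
Connected G = ∀ u v → ∃[ k ] Walk G u v k

IsGraphDistance : (G : Graph) → (Vertex G → Vertex G → ℕ) → Set
IsGraphDistance G d =
  (∀ u v → Walk G u v (d u v)) × (∀ u v k → Walk G u v k → d u v ≤ k)

Distribution : Graph → Set
Distribution G = Vertex G → ℕ

Positive : (G : Graph) → Distribution G → Set
Positive G W = ∀ v → 1 ≤ W v

-- Result of the pebbling move P_{p,q} applied to D (p ≠ q since p,q adjacent).
moveResult : (G : Graph) → Distribution G → Vertex G → Vertex G → Distribution G
moveResult G D p q r with r ≟ p
... | yes _ = D p ∸ 2
... | no _ with r ≟ q
...   | yes _ = suc (D q)
...   | no _ = D r

PebblingStep : (G : Graph) → Distribution G → Distribution G → Set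
PebblingStep G D D' =
  Σ (Vertex G) λ p → Σ (Vertex G) λ q →
    Adj G p q × 2 ≤ D p × (∀ r → D' r ≡ moveResult G D p q r)

Derivable : (G : Graph) → Distribution G → Distribution G → Set
Derivable G D D' =
  Σ (Distribution G) λ E → Star (PebblingStep G) D E × (∀ r → E r ≡ D' r)

weightV : (G : Graph) → (Vertex G → Vertex G → ℕ) → Vertex G → Distribution G → ℕ
weightV G d v0 D = sum (map (λ q → D q * 2 ^ d q v0) (allFin (n G)))

{-# OPTIONS --safe #-}
-- If D(v0) > W(v0), then V(D) ≤ V(W) forces some s with D(s) < W(s). Moving two pebbles from a
-- vertex to a neighbour one step further from v0 preserves V, because the factor 2^d doubles.
-- So push pebbles from v0 along a shortest path towards s: every vertex on the way that is at or
-- above its bound receives one pebble and sends two on (a net loss of one), and the first vertex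
-- below its bound keeps the pebble. This costs v0 two pebbles and keeps every other vertex within
-- its bound, so repeating it terminates with a distribution bounded by W.
module Submission where

open import Defs hiding (sym)
open import Data.Nat using (ℕ; zero; suc; _+_; _*_; _∸_; _^_; _≤_; _<_; z≤n; s≤s; _≤?_; _<?_; NonZero)
open import Data.Nat.Properties
  using (+-0-commutativeMonoid; ≤-trans; <-trans; ≤-reflexive; <-irrefl; <-asym; <⇒≱; ≰⇒>; ≮⇒≥;
         ≤-pred; ≤-antisym; suc-injective; m≤m+n; m<m+n; +-mono-≤; +-mono-<-≤; +-mono-≤-<;
         +-identityʳ; *-identityˡ; +-comm; +-suc; +-cancelʳ-≡; *-monoˡ-≤; *-monoˡ-<; *-distribʳ-+;
         m∸n+n≡m; m^n≢0)
open import Data.Nat.Induction using (<-wellFounded)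
open import Data.Fin using (Fin; zero; suc; punchIn)
open import Data.Fin.Properties using (_≟_; any?; punchInᵢ≢i)
open import Data.List using (tabulate; map; allFin)
open import Data.List.Properties using (map-tabulate)
open import Data.Nat.ListAction using (sum)
open import Data.Product using (Σ; _×_; _,_; proj₁; proj₂)
open import Data.Empty using (⊥-elim)
open import Function using (_∘_)
open import Induction.WellFounded using (Acc; acc)
open import Relation.Nullary using (¬_; Dec; yes; no)
open import Relation.Binary.PropositionalEquality
  using (_≡_; _≢_; _≗_; refl; sym; trans; cong; cong₂; subst; subst₂; module ≡-Reasoning)
open import Relation.Binary.Construct.Closure.ReflexiveTransitive using (Star; ε; _◅_; _◅◅_)
open import Algebra.Properties.CommutativeMonoid.Sum +-0-commutativeMonoid
  using (∑-distrib-+; sum-remove; sum-cong-≗; sum-replicate-zero)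
  renaming (sum to ∑)

m+2≡1+n⇒m≤n : ∀ {m n} → m + 2 ≡ suc n → m ≤ n
m+2≡1+n⇒m≤n {m} eq = ≤-trans (m≤m+n m 1) (≤-reflexive (suc-injective (trans (sym (+-suc m 1)) eq)))

sum-tabulate : ∀ {n} (f : Fin n → ℕ) → sum (tabulate f) ≡ ∑ f
sum-tabulate {zero} f = refl
sum-tabulate {suc n} f = cong (f zero +_) (sum-tabulate (f ∘ suc))

sum-map-allFin : ∀ {n} (f : Fin n → ℕ) → sum (map f (allFin n)) ≡ ∑ f
sum-map-allFin f = trans (cong sum (map-tabulate (λ i → i) f)) (sum-tabulate f)

∑-mono-≤ : ∀ {n} {f g : Fin n → ℕ} → (∀ i → f i ≤ g i) → ∑ f ≤ ∑ g
∑-mono-≤ {zero} f≤g = z≤n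
∑-mono-≤ {suc n} f≤g = +-mono-≤ (f≤g zero) (∑-mono-≤ (f≤g ∘ suc))

∑-mono-< : ∀ {n} {f g : Fin n → ℕ} (i : Fin n) → (∀ j → f j ≤ g j) → f i < g i → ∑ f < ∑ g
∑-mono-< zero f≤g fi<gi = +-mono-<-≤ fi<gi (∑-mono-≤ (f≤g ∘ suc))
∑-mono-< (suc i) f≤g fi<gi = +-mono-≤-< (f≤g zero) (∑-mono-< i (f≤g ∘ suc) fi<gi)

point : ∀ {n} → Fin n → ℕ → Fin n → ℕ
point p k r with r ≟ p
... | yes _ = k
... | no _ = 0

point-here : ∀ {n} (p : Fin n) k → point p k p ≡ k
point-here p k with p ≟ p
... | yes _ = refl
... | no p≢p = ⊥-elim (p≢p refl)

point-elsewhere : ∀ {n} {p r : Fin n} k → r ≢ p → point p k r ≡ 0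
point-elsewhere {p = p} {r} k r≢p with r ≟ p
... | yes r≡p = ⊥-elim (r≢p r≡p)
... | no _ = refl

∑-point-* : ∀ {n} (p : Fin n) k (f : Fin n → ℕ) → ∑ (λ r → point p k r * f r) ≡ k * f p
∑-point-* {suc n} p k f = begin
  ∑ t                                  ≡⟨ sum-remove {i = p} t ⟩
  t p + ∑ (t ∘ punchIn p)              ≡⟨ cong₂ _+_ (cong (_* f p) (point-here p k)) (sum-cong-≗ vanishes) ⟩
  k * f p + ∑ {n} (λ _ → 0)           ≡⟨ cong (k * f p +_) (sum-replicate-zero n) ⟩
  k * f p + 0                          ≡⟨ +-identityʳ _ ⟩
  k * f p                              ∎
  where
  open ≡-Reasoning
  t : Fin (suc n) → ℕ
  t r = point p k r * f r
  vanishes : t ∘ punchIn p ≗ (λ _ → 0)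
  vanishes j = cong (_* f (punchIn p j)) (point-elsewhere k (punchInᵢ≢i p j))

weighted : ∀ {n} → (Fin n → ℕ) → (Fin n → ℕ) → ℕ
weighted c D = ∑ (λ r → D r * c r)

weighted-cong : ∀ {n} (c : Fin n → ℕ) {D E : Fin n → ℕ} → D ≗ E → weighted c D ≡ weighted c E
weighted-cong c D≗E = sum-cong-≗ (λ r → cong (_* c r) (D≗E r))

weighted-+-point : ∀ {n} (c D : Fin n → ℕ) p k →
                   weighted c (λ r → D r + point p k r) ≡ weighted c D + k * c p
weighted-+-point c D p k = begin
  ∑ (λ r → (D r + point p k r) * c r)              ≡⟨ sum-cong-≗ (λ r → *-distribʳ-+ (c r) (D r) (point p k r)) ⟩
  ∑ (λ r → D r * c r + point p k r * c r)          ≡⟨ ∑-distrib-+ (λ r → D r * c r) (λ r → point p k r * c r) ⟩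
  weighted c D + ∑ (λ r → point p k r * c r)       ≡⟨ cong (weighted c D +_) (∑-point-* p k c) ⟩
  weighted c D + k * c p                           ∎
  where open ≡-Reasoning

weighted-mono-< : ∀ {n} (c : Fin n → ℕ) {D E : Fin n → ℕ} p .{{_ : NonZero (c p)}} →
                  (∀ r → D r ≤ E r) → D p < E p → weighted c D < weighted c E
weighted-mono-< c p D≤E Dp<Ep = ∑-mono-< p (λ r → *-monoˡ-≤ (c r) (D≤E r)) (*-monoˡ-< (c p) Dp<Ep)

module _ (G : Graph) (D : Distribution G) {p q : Vertex G} where

  moveResult-source : moveResult G D p q p ≡ D p ∸ 2
  moveResult-source with p ≟ p
  ... | yes _ = refl
  ... | no p≢p = ⊥-elim (p≢p refl)

  moveResult-target : p ≢ q → moveResult G D p q q ≡ suc (D q)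
  moveResult-target p≢q with q ≟ p
  ... | yes q≡p = ⊥-elim (p≢q (sym q≡p))
  ... | no _ with q ≟ q
  ...   | yes _ = refl
  ...   | no q≢q = ⊥-elim (q≢q refl)

  moveResult-other : ∀ {r} → r ≢ p → r ≢ q → moveResult G D p q r ≡ D r
  moveResult-other {r} r≢p r≢q with r ≟ p
  ... | yes r≡p = ⊥-elim (r≢p r≡p)
  ... | no _ with r ≟ q
  ...   | yes r≡q = ⊥-elim (r≢q r≡q)
  ...   | no _ = refl

  moveResult-balance : p ≢ q → 2 ≤ D p →
                       ∀ r → moveResult G D p q r + point p 2 r ≡ D r + point q 1 r
  moveResult-balance p≢q 2≤Dp r = by-cases (r ≟ p) (r ≟ q)
    where
    open ≡-Reasoning
    by-cases : Dec (r ≡ p) → Dec (r ≡ q) → moveResult G D p q r + point p 2 r ≡ D r + point q 1 r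
    by-cases (yes refl) _ = begin
      moveResult G D r q r + point r 2 r   ≡⟨ cong₂ _+_ moveResult-source (point-here r 2) ⟩
      D r ∸ 2 + 2                          ≡⟨ m∸n+n≡m 2≤Dp ⟩
      D r                                  ≡⟨ +-identityʳ (D r) ⟨
      D r + 0                              ≡⟨ cong (D r +_) (point-elsewhere 1 p≢q) ⟨
      D r + point q 1 r                    ∎
    by-cases (no r≢p) (yes refl) = begin
      moveResult G D p r r + point p 2 r   ≡⟨ cong₂ _+_ (moveResult-target p≢q) (point-elsewhere 2 r≢p) ⟩
      suc (D r) + 0                        ≡⟨ +-identityʳ (suc (D r)) ⟩
      suc (D r)                            ≡⟨ +-comm 1 (D r) ⟩
      D r + 1                              ≡⟨ cong (D r +_) (point-here r 1) ⟨
      D r + point r 1 r                    ∎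
    by-cases (no r≢p) (no r≢q) = begin
      moveResult G D p q r + point p 2 r   ≡⟨ cong₂ _+_ (moveResult-other r≢p r≢q) (point-elsewhere 2 r≢p) ⟩
      D r + 0                              ≡⟨ cong (D r +_) (point-elsewhere 1 r≢q) ⟨
      D r + point q 1 r                    ∎

moveResult-preserves-weighted : ∀ G (c : Vertex G → ℕ) (D : Distribution G) {p q} →
                                p ≢ q → 2 ≤ D p → c q ≡ 2 * c p →
                                weighted c (moveResult G D p q) ≡ weighted c D
moveResult-preserves-weighted G c D {p} {q} p≢q 2≤Dp cq≡2cp = +-cancelʳ-≡ (2 * c p) _ _ (begin
  weighted c D′ + 2 * c p                 ≡⟨ weighted-+-point c D′ p 2 ⟨
  weighted c (λ r → D′ r + point p 2 r)   ≡⟨ weighted-cong c (moveResult-balance G D p≢q 2≤Dp) ⟩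
  weighted c (λ r → D r + point q 1 r)    ≡⟨ weighted-+-point c D q 1 ⟩
  weighted c D + 1 * c q                  ≡⟨ cong (weighted c D +_) (trans (*-identityˡ (c q)) cq≡2cp) ⟩
  weighted c D + 2 * c p                  ∎)
  where
  open ≡-Reasoning
  D′ = moveResult G D p q

module Levels (G : Graph) (d : Vertex G → Vertex G → ℕ) (isd : IsGraphDistance G d) (v0 : Vertex G) where

  level : Vertex G → ℕ
  level r = d r v0

  <-level⇒≢ : ∀ {r x} → level r < level x → r ≢ x
  <-level⇒≢ lt refl = <-irrefl refl lt

  data Ascent : Vertex G → Vertex G → Set where
    arrived : ∀ {s} → Ascent s s
    up      : ∀ {u w s} → Adj G u w → level w ≡ suc (level u) → Ascent w s → Ascent u s

  -- Read backwards, a shortest walk from x to v0 climbs one level per step.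
  ascent-via-geodesic : ∀ {x s k} → Walk G x v0 k → level x ≡ k → Ascent x s → Ascent v0 s
  ascent-via-geodesic here _ x⇝s = x⇝s
  ascent-via-geodesic {x} (step {w = y} {k = k} x~y y⇝v0) level-x≡1+k x⇝s =
    ascent-via-geodesic y⇝v0 level-y≡k (up (Graph.sym G x~y) level-x≡1+level-y x⇝s)
    where
    level-y≡k : level y ≡ k
    level-y≡k = ≤-antisym (proj₂ isd y v0 k y⇝v0)
      (≤-pred (subst (_≤ suc (level y)) level-x≡1+k (proj₂ isd x v0 _ (step x~y (proj₁ isd y v0)))))
    level-x≡1+level-y : level x ≡ suc (level y)
    level-x≡1+level-y = trans level-x≡1+k (cong suc (sym level-y≡k))

  ascent-to : ∀ s → Ascent v0 s
  ascent-to s = ascent-via-geodesic (proj₁ isd s v0) refl arrived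

module Settling (G : Graph) (d : Vertex G → Vertex G → ℕ) (isd : IsGraphDistance G d)
                (W : Distribution G) (W-positive : Positive G W) (v0 : Vertex G) where

  open Levels G d isd v0

  weight : Distribution G → ℕ
  weight = weighted (λ r → 2 ^ level r)

  record Push (D : Distribution G) (u : Vertex G) : Set where
    field
      result           : Distribution G
      derivation       : Star (PebblingStep G) D result
      preserves-weight : weight result ≡ weight D
      source-loses-two : result u + 2 ≡ D u
      fixes-below      : ∀ r → level r < level u → result r ≡ D r
      preserves-bound  : ∀ r → r ≢ u → D r ≤ W r → result r ≤ W r

  module Move (D : Distribution G) {u w : Vertex G}
              (u~w : Adj G u w) (level-w≡1+level-u : level w ≡ suc (level u)) (Wu<Du : W u < D u) where

    u≢w : u ≢ w
    u≢w refl = Graph.irrefl G u~w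

    2≤Du : 2 ≤ D u
    2≤Du = ≤-trans (s≤s (W-positive u)) Wu<Du

    level-u<level-w : level u < level w
    level-u<level-w = ≤-reflexive (sym level-w≡1+level-u)

    D′ : Distribution G
    D′ = moveResult G D u w

    move : PebblingStep G D D′
    move = u , w , u~w , 2≤Du , λ _ → refl

    move-preserves-weight : weight D′ ≡ weight D
    move-preserves-weight =
      moveResult-preserves-weighted G _ D u≢w 2≤Du (cong (2 ^_) level-w≡1+level-u)

    move-source : D′ u + 2 ≡ D u
    move-source = trans (cong (_+ 2) (moveResult-source G D)) (m∸n+n≡m 2≤Du)

    move-target : D′ w ≡ suc (D w)
    move-target = moveResult-target G D u≢w

    move-fixes-others : ∀ {r} → r ≢ u → r ≢ w → D′ r ≡ D r
    move-fixes-others = moveResult-other G D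

    move-fixes-below : ∀ r → level r < level u → D′ r ≡ D r
    move-fixes-below r lt = move-fixes-others (<-level⇒≢ lt) (<-level⇒≢ (<-trans lt level-u<level-w))

    preserves-bound-if : ∀ (E : Distribution G) → (D w ≤ W w → E w ≤ W w) →
                         (∀ r → r ≢ w → D′ r ≤ W r → E r ≤ W r) →
                         ∀ r → r ≢ u → D r ≤ W r → E r ≤ W r
    preserves-bound-if E target others r r≢u Dr≤Wr with r ≟ w
    ... | yes refl = target Dr≤Wr
    ... | no r≢w = others r r≢w (subst (_≤ W r) (sym (move-fixes-others r≢u r≢w)) Dr≤Wr)

  push : ∀ {D u s} → Ascent u s → D s < W s → W u < D u → Push D u
  push arrived Ds<Ws Ws<Ds = ⊥-elim (<-asym Ds<Ws Ws<Ds)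
  push {D} {u} {s} (up {w = w} u~w level-w w⇝s) Ds<Ws Wu<Du with D w <? W w
  ... | yes Dw<Ww = record
    { result           = D′
    ; derivation       = move ◅ ε
    ; preserves-weight = move-preserves-weight
    ; source-loses-two = move-source
    ; fixes-below      = move-fixes-below
    ; preserves-bound  = preserves-bound-if D′ (λ _ → subst (_≤ W w) (sym move-target) Dw<Ww)
                                               (λ _ _ D′r≤Wr → D′r≤Wr)
    }
    where open Move D u~w level-w Wu<Du
  ... | no Dw≮Ww = record
    { result           = P.result
    ; derivation       = move ◅ P.derivation
    ; preserves-weight = trans P.preserves-weight move-preserves-weight
    ; source-loses-two = trans (cong (_+ 2) (P.fixes-below u level-u<level-w)) move-source
    ; fixes-below      = λ r lt → trans (P.fixes-below r (<-trans lt level-u<level-w)) (move-fixes-below r lt)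
    ; preserves-bound  = preserves-bound-if P.result
        (≤-trans (m+2≡1+n⇒m≤n (trans P.source-loses-two move-target))) P.preserves-bound
    }
    where
    open Move D u~w level-w Wu<Du
    s≢u : s ≢ u
    s≢u refl = <-asym Ds<Ws Wu<Du
    s≢w : s ≢ w
    s≢w refl = Dw≮Ww Ds<Ws
    module P = Push (push w⇝s (subst (_< W s) (sym (move-fixes-others s≢u s≢w)) Ds<Ws)
                              (subst (W w <_) (sym move-target) (s≤s (≮⇒≥ Dw≮Ww))))

  weightV≡weight : ∀ D → weightV G d v0 D ≡ weight D
  weightV≡weight D = sum-map-allFin (λ r → D r * 2 ^ level r)

  weight-< : ∀ {D} → (∀ r → W r ≤ D r) → W v0 < D v0 → weight W < weight D
  weight-< = weighted-mono-< _ v0 {{m^n≢0 2 (level v0)}}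

  Settled : Distribution G → Set
  Settled D = Σ (Distribution G) λ D* →
    Star (PebblingStep G) D D* × (∀ q → D* q ≤ W q) × weight D* ≡ weight D

  settled-after : ∀ {D E} → Star (PebblingStep G) D E → weight E ≡ weight D → Settled E → Settled D
  settled-after D⇝E wE≡wD (D* , E⇝D* , D*≤W , wD*≡wE) = D* , D⇝E ◅◅ E⇝D* , D*≤W , trans wD*≡wE wE≡wD

  settle : ∀ D → Acc _<_ (D v0) → (∀ s → s ≢ v0 → D s ≤ W s) → weight D ≤ weight W → Settled D
  settle D _ bounded light with D v0 ≤? W v0
  ... | yes Dv0≤Wv0 = D , ε , bounded-everywhere , refl
    where
    bounded-everywhere : ∀ q → D q ≤ W q
    bounded-everywhere q with q ≟ v0
    ... | yes refl = Dv0≤Wv0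
    ... | no q≢v0 = bounded q q≢v0
  settle D (acc smaller) bounded light | no Dv0≰Wv0 with any? (λ s → D s <? W s)
  ... | no saturated =
    ⊥-elim (<⇒≱ (weight-< (λ r → ≮⇒≥ (λ Dr<Wr → saturated (r , Dr<Wr))) (≰⇒> Dv0≰Wv0)) light)
  ... | yes (s , Ds<Ws) = settled-after P.derivation P.preserves-weight
    (settle P.result (smaller decreases) bounded′ (subst (_≤ weight W) (sym P.preserves-weight) light))
    where
    module P = Push (push (ascent-to s) Ds<Ws (≰⇒> Dv0≰Wv0))
    decreases : P.result v0 < D v0
    decreases = subst (P.result v0 <_) P.source-loses-two (m<m+n (P.result v0) (s≤s z≤n))
    bounded′ : ∀ r → r ≢ v0 → P.result r ≤ W r
    bounded′ r r≢v0 = P.preserves-bound r r≢v0 (bounded r r≢v0)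

lemma2 : (G : Graph) → Connected G →
    (d : Vertex G → Vertex G → ℕ) → IsGraphDistance G d →
    (W : Distribution G) → Positive G W →
    (v0 : Vertex G) → (D : Distribution G) →
    (∀ s → ¬ s ≡ v0 → D s ≤ W s) →
    weightV G d v0 D ≤ weightV G d v0 W →
    Σ (Distribution G) λ Dstar →
      Derivable G D Dstar × (∀ q → Dstar q ≤ W q) × weightV G d v0 Dstar ≡ weightV G d v0 D
lemma2 G _ d isd W W-positive v0 D bounded light =
  let D* , D⇝D* , D*≤W , wD*≡wD = settle D (<-wellFounded (D v0)) bounded
                                      (subst₂ _≤_ (weightV≡weight D) (weightV≡weight W) light)
  in D* , (D* , D⇝D* , λ _ → refl) , D*≤W ,
     trans (weightV≡weight D*) (trans wD*≡wD (sym (weightV≡weight D)))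
  where open Settling G d isd W W-positive v0
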